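{- Let $b(n)$ be defined by $\sum_{n\ge0} b(n)q^n=\mathcal{B}(q)$. Let $p$ be an odd prime and $1\le\ell\le p-1$ an integer with $\left(\frac{4\ell+1}{p}\right)_L=-1$. Then for all $n\ge0$ and $k\ge0$, \[b\left(2p^{2k+3}n+\frac{(4\ell+1)p^{2k+2}-1}{2}\right)\equiv0\pmod 4.\]
   Context: $(a;q)_n=\prod_{j=0}^{n-1}(1-aq^j)$ for $|q|<1$. McIntosh's second order mock theta function is $\mathcal{B}(q)=\sum_{n\ge0}\frac{q^n(-q;q^2)_n}{(q;q^2)_{n+1}}$. $\left(\frac{\cdot}{p}\right)_L$ denotes the Legendre symbol. -}

module Defs where

open import Data.Nat using (ℕ; zero; suc; _+_; _*_; _∸_; _%_; _≡ᵇ_; NonZero)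
open import Data.Bool using (Bool; true; false; if_then_else_)
open import Data.List using (upTo)
open import Data.Bool.ListAction using (any)
open import Data.Integer using (ℤ; +_; -[1+_])

-- Formal power series with natural-number coefficients: n ↦ coefficient of q^n.
Ser : Set
Ser = ℕ → ℕ

sumTo : ℕ → (ℕ → ℕ) → ℕ
sumTo zero    f = f 0
sumTo (suc n) f = sumTo n f + f (suc n)

_⊛_ : Ser → Ser → Ser
(f ⊛ g) n = sumTo n (λ i → f i * g (n ∸ i))

oneS : Ser
oneS n = if n ≡ᵇ 0 then 1 else 0

monoS : ℕ → Ser
monoS m n = if n ≡ᵇ m then 1 else 0

onePlusOdd : ℕ → Ser
onePlusOdd j n = (if n ≡ᵇ 0 then 1 else 0) + (if n ≡ᵇ suc (2 * j) then 1 else 0)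

-- 1 / (1 - q^(2j+1)) = Σ_t q^{t(2j+1)}
geoOdd : ℕ → Ser
geoOdd j n = if n % suc (2 * j) ≡ᵇ 0 then 1 else 0

prodS : ℕ → (ℕ → Ser) → Ser
prodS zero    f = oneS
prodS (suc m) f = prodS m f ⊛ f m

-- q^m (-q;q^2)_m / (q;q^2)_{m+1}
termB : ℕ → Ser
termB m = monoS m ⊛ (prodS m onePlusOdd ⊛ prodS (suc m) geoOdd)

-- b(n) = coefficient of q^n in McIntosh's B(q) = Σ_{m≥0} termB m.
-- termB m has q-adic valuation ≥ m, so only m ≤ n contribute to q^n.
b : ℕ → ℕ
b n = sumTo n (λ m → termB m n)

legendre : (a p : ℕ) → .{{NonZero p}} → ℤ
legendre a p =
  if a % p ≡ᵇ 0 then + 0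
  else if any (λ x → (x * x) % p ≡ᵇ a % p) (upTo p) then + 1
  else -[1+ 0 ]

{-# OPTIONS --safe #-}
-- Modulo 4, (1 + x)/(1 − x) = 1 + 2x/(1 − x) and (1 + 2A)(1 + 2B) ≡ 1 + 2(A + B), so
-- (-q;q²)ₙ/(q;q²)ₙ ≡ 1 + 2 Σ_{j<n} q^(2j+1)/(1 − q^(2j+1)). Reading off coefficients,
-- b(m) ≡ D + 2E (mod 4), where D counts the factorisations (2i+1)(2j+1) = 2m+1 and E counts
-- the solutions of quadForm j e s t = 2m+1. Let 2m+1 ≡ 1 (mod 4) be a non-square. Then
-- D = 2Y, with Y the number of factorisations with i < j. The involution
-- (j,e,s,t) ↦ (t,s,e,j) gives E ≡ (number of its fixed points) (mod 2). These fixed points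
-- are exactly the factorisations with i < j, because both factors are ≡ 1 or both ≡ 3
-- (mod 4); so E ≡ Y (mod 2) and b(m) ≡ 4Y ≡ 0. For the corollary,
-- 2m+1 = p^(2k+2)(4ℓ+1+4pn), which is not a square because 4ℓ+1 is a non-residue mod p.
module Submission where

open import Data.Bool using (true; false; if_then_else_; T)
open import Data.Bool.ListAction using (any)
open import Data.Integer using (-[1+_])
open import Data.List using (upTo)
open import Data.List.Membership.Propositional using (lose)
open import Data.List.Membership.Propositional.Properties using (∈-upTo⁺)
open import Data.List.Relation.Unary.Any.Properties using (any⁺)
open import Data.Nat
open import Data.Nat.DivMod
open import Data.Nat.Divisibility using (_∣_; divides; m%n≡0⇒n∣m; hasNonTrivialDivisor-≢)
open import Data.Nat.Primality using (Prime; Composite; prime⇒nonZero; euclidsLemma)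
open import Data.Nat.Properties
open import Data.Nat.Tactic.RingSolver using (solve-∀)
open import Data.Product using (∃; _×_; _,_; proj₁; proj₂)
open import Data.Sum using (_⊎_; inj₁; inj₂; [_,_]′)
open import Function using (_∘_)
open import Relation.Binary.Definitions using (tri<; tri≈; tri>)
open import Relation.Binary.PropositionalEquality
open import Relation.Nullary using (Dec; yes; no; does; ¬_; contradiction)
open import Relation.Unary using (Decidable)
open import Defs

open ≡-Reasoning

private variable A B : Set

-- Iverson brackets and finite sums

𝟙 : Dec A → ℕ
𝟙 d = if does d then 1 else 0

𝟙-yes : (d : Dec A) → A → 𝟙 d ≡ 1
𝟙-yes (yes _) _ = refl
𝟙-yes (no ¬a) a = contradiction a ¬a

𝟙-no : (d : Dec A) → ¬ A → 𝟙 d ≡ 0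
𝟙-no (yes a) ¬a = contradiction a ¬a
𝟙-no (no _)  _  = refl

𝟙-toWitness : (d : Dec A) → 𝟙 d ≢ 0 → A
𝟙-toWitness (yes a) _  = a
𝟙-toWitness (no _)  ≢0 = contradiction refl ≢0

𝟙-cong : (d : Dec A) (e : Dec B) → (A → B) → (B → A) → 𝟙 d ≡ 𝟙 e
𝟙-cong (yes a) e       f _ = sym (𝟙-yes e (f a))
𝟙-cong (no ¬a) (yes b) _ g = contradiction (g b) ¬a
𝟙-cong (no _)  (no _)  _ _ = refl

𝟙-trichotomy : ∀ i j → 𝟙 (i <? j) + 𝟙 (j ≟ i) + 𝟙 (j <? i) ≡ 1
𝟙-trichotomy i j with <-cmp i j
... | tri< i<j i≢j _
  rewrite 𝟙-yes (i <? j) i<j | 𝟙-no (j ≟ i) (i≢j ∘ sym) | 𝟙-no (j <? i) (<⇒≯ i<j) = refl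
... | tri≈ i≮j refl _
  rewrite 𝟙-no (i <? i) i≮j | 𝟙-yes (i ≟ i) refl = refl
... | tri> _ i≢j j<i
  rewrite 𝟙-no (i <? j) (<⇒≯ j<i) | 𝟙-no (j ≟ i) (i≢j ∘ sym) | 𝟙-yes (j <? i) j<i = refl

𝟙<-suc : ∀ j n → 𝟙 (j <? suc n) ≡ 𝟙 (j <? n) + 𝟙 (j ≟ n)
𝟙<-suc j n with <-cmp j n
... | tri< j<n j≢n _
  rewrite 𝟙-yes (j <? suc n) (m≤n⇒m≤1+n j<n) | 𝟙-yes (j <? n) j<n | 𝟙-no (j ≟ n) j≢n = refl
... | tri≈ j≮n refl _
  rewrite 𝟙-yes (j <? suc j) ≤-refl | 𝟙-no (j <? j) j≮n | 𝟙-yes (j ≟ j) refl = refl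
... | tri> j≮n j≢n n<j
  rewrite 𝟙-no (j <? suc n) (<⇒≱ n<j ∘ ≤-pred) | 𝟙-no (j <? n) j≮n | 𝟙-no (j ≟ n) j≢n = refl

sumTo-cong : ∀ n {f g : ℕ → ℕ} → (∀ i → i ≤ n → f i ≡ g i) → sumTo n f ≡ sumTo n g
sumTo-cong zero    f≡g = f≡g 0 z≤n
sumTo-cong (suc n) f≡g =
  cong₂ _+_ (sumTo-cong n (λ i i≤n → f≡g i (m≤n⇒m≤1+n i≤n))) (f≡g (suc n) ≤-refl)

sumTo-ext : ∀ n {f g : ℕ → ℕ} → f ≗ g → sumTo n f ≡ sumTo n g
sumTo-ext n f≗g = sumTo-cong n (λ i _ → f≗g i)

sumTo-zero : ∀ n {f : ℕ → ℕ} → (∀ i → i ≤ n → f i ≡ 0) → sumTo n f ≡ 0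
sumTo-zero zero    f≡0 = f≡0 0 z≤n
sumTo-zero (suc n) f≡0 =
  cong₂ _+_ (sumTo-zero n (λ i i≤n → f≡0 i (m≤n⇒m≤1+n i≤n))) (f≡0 (suc n) ≤-refl)

sumTo-+ : ∀ n (f g : ℕ → ℕ) → sumTo n (λ i → f i + g i) ≡ sumTo n f + sumTo n g
sumTo-+ zero    f g = refl
sumTo-+ (suc n) f g = begin
  sumTo n (λ i → f i + g i) + (f (suc n) + g (suc n))
    ≡⟨ cong (_+ (f (suc n) + g (suc n))) (sumTo-+ n f g) ⟩
  sumTo n f + sumTo n g + (f (suc n) + g (suc n))
    ≡⟨ +-interchange (sumTo n f) (sumTo n g) _ _ ⟩
  sumTo n f + f (suc n) + (sumTo n g + g (suc n)) ∎
  where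
  +-interchange : ∀ a b c d → (a + b) + (c + d) ≡ (a + c) + (b + d)
  +-interchange = solve-∀

sumTo-*ˡ : ∀ n c (f : ℕ → ℕ) → sumTo n (λ i → c * f i) ≡ c * sumTo n f
sumTo-*ˡ zero    c f = refl
sumTo-*ˡ (suc n) c f =
  trans (cong (_+ c * f (suc n)) (sumTo-*ˡ n c f)) (sym (*-distribˡ-+ c (sumTo n f) _))

sumTo-*ʳ : ∀ n c (f : ℕ → ℕ) → sumTo n (λ i → f i * c) ≡ sumTo n f * c
sumTo-*ʳ n c f = trans (sumTo-ext n (λ i → *-comm (f i) c)) (trans (sumTo-*ˡ n c f) (*-comm c _))

sumTo-swap : ∀ n k (F : ℕ → ℕ → ℕ) →
             sumTo n (λ i → sumTo k (F i)) ≡ sumTo k (λ j → sumTo n (λ i → F i j))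
sumTo-swap zero    k F = refl
sumTo-swap (suc n) k F =
  trans (cong (_+ sumTo k (F (suc n))) (sumTo-swap n k F)) (sym (sumTo-+ k _ _))

sumTo-unfoldˡ : ∀ n (f : ℕ → ℕ) → sumTo (suc n) f ≡ f 0 + sumTo n (f ∘ suc)
sumTo-unfoldˡ zero    f = refl
sumTo-unfoldˡ (suc n) f =
  trans (cong (_+ f (suc (suc n))) (sumTo-unfoldˡ n f)) (+-assoc (f 0) _ _)

sumTo-reverse : ∀ n (f : ℕ → ℕ) → sumTo n f ≡ sumTo n (λ i → f (n ∸ i))
sumTo-reverse zero    f = refl
sumTo-reverse (suc n) f = begin
  sumTo n f + f (suc n)                    ≡⟨ cong (_+ f (suc n)) (sumTo-reverse n f) ⟩
  sumTo n (λ i → f (n ∸ i)) + f (suc n)    ≡⟨ +-comm _ (f (suc n)) ⟩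
  f (suc n) + sumTo n (λ i → f (n ∸ i))    ≡⟨ sumTo-unfoldˡ n (λ i → f (suc n ∸ i)) ⟨
  sumTo (suc n) (λ i → f (suc n ∸ i))      ∎

sumTo-triangle : ∀ n (F : ℕ → ℕ → ℕ) →
                 sumTo n (λ i → sumTo i (λ a → F a i))
                 ≡ sumTo n (λ a → sumTo (n ∸ a) (λ k → F a (a + k)))
sumTo-triangle zero    F = refl
sumTo-triangle (suc n) F = begin
  sumTo n (λ i → sumTo i (λ a → F a i)) + (sumTo n Column + F (suc n) (suc n))
    ≡⟨ cong (_+ (sumTo n Column + F (suc n) (suc n))) (sumTo-triangle n F) ⟩
  sumTo n (Row n) + (sumTo n Column + F (suc n) (suc n))
    ≡⟨ +-assoc (sumTo n (Row n)) _ _ ⟨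
  sumTo n (Row n) + sumTo n Column + F (suc n) (suc n)
    ≡⟨ cong (_+ F (suc n) (suc n)) (trans (sym (sumTo-+ n (Row n) Column)) (sumTo-cong n extend-row)) ⟩
  sumTo n (Row (suc n)) + F (suc n) (suc n)
    ≡⟨ cong (sumTo n (Row (suc n)) +_) last-row ⟨
  sumTo (suc n) (Row (suc n)) ∎
  where
  Row : ℕ → ℕ → ℕ
  Row l a = sumTo (l ∸ a) (λ k → F a (a + k))
  Column : ℕ → ℕ
  Column a = F a (suc n)
  extend-row : ∀ a → a ≤ n → Row n a + Column a ≡ Row (suc n) a
  extend-row a a≤n = begin
    Row n a + F a (suc n)
      ≡⟨ cong (λ x → Row n a + F a x) (trans (+-suc a (n ∸ a)) (cong suc (m+[n∸m]≡n a≤n))) ⟨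
    sumTo (suc (n ∸ a)) (λ k → F a (a + k))
      ≡⟨ cong (λ x → sumTo x (λ k → F a (a + k))) (+-∸-assoc 1 a≤n) ⟨
    Row (suc n) a ∎
  last-row : Row (suc n) (suc n) ≡ F (suc n) (suc n)
  last-row = trans (cong (λ x → sumTo x (λ k → F (suc n) (suc n + k))) (n∸n≡0 n))
                   (cong (F (suc n)) (+-identityʳ (suc n)))

sumTo-𝟙≟-> : ∀ {n t} (g : ℕ → ℕ) → n < t → sumTo n (λ i → 𝟙 (i ≟ t) * g i) ≡ 0
sumTo-𝟙≟-> {t = t} g n<t =
  sumTo-zero _ (λ i i≤n → cong (_* g i) (𝟙-no (i ≟ t) (λ { refl → <⇒≱ n<t i≤n })))

sumTo-𝟙≟-≤ : ∀ {n t} (g : ℕ → ℕ) → t ≤ n → sumTo n (λ i → 𝟙 (i ≟ t) * g i) ≡ g t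
sumTo-𝟙≟-≤ {zero}      g z≤n = +-identityʳ (g 0)
sumTo-𝟙≟-≤ {suc n} {t} g t≤1+n with m≤n⇒m<n∨m≡n t≤1+n
... | inj₁ t<1+n = begin
  sumTo n (λ i → 𝟙 (i ≟ t) * g i) + 𝟙 (suc n ≟ t) * g (suc n)
    ≡⟨ cong₂ _+_ (sumTo-𝟙≟-≤ g (≤-pred t<1+n))
                 (cong (_* g (suc n)) (𝟙-no (suc n ≟ t) (<⇒≢ t<1+n ∘ sym))) ⟩
  g t + 0
    ≡⟨ +-identityʳ (g t) ⟩
  g t ∎
... | inj₂ refl = begin
  sumTo n (λ i → 𝟙 (i ≟ suc n) * g i) + 𝟙 (suc n ≟ suc n) * g (suc n)
    ≡⟨ cong₂ _+_ (sumTo-𝟙≟-> {n} g ≤-refl) (cong (_* g (suc n)) (𝟙-yes (suc n ≟ suc n) refl)) ⟩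
  g (suc n) + 0
    ≡⟨ +-identityʳ (g (suc n)) ⟩
  g (suc n) ∎

sumTo-𝟙≟ : ∀ n t (g : ℕ → ℕ) → sumTo n (λ i → 𝟙 (i ≟ t) * g i) ≡ 𝟙 (t ≤? n) * g t
sumTo-𝟙≟ n t g with t ≤? n
... | yes t≤n =
  trans (sumTo-𝟙≟-≤ g t≤n) (sym (trans (cong (_* g t) (𝟙-yes (t ≤? n) t≤n)) (+-identityʳ (g t))))
... | no  t≰n =
  trans (sumTo-𝟙≟-> g (≰⇒> t≰n)) (sym (cong (_* g t) (𝟙-no (t ≤? n) t≰n)))

sumTo-𝟙-none : ∀ K {P : ℕ → Set} (P? : Decidable P) → (∀ i → i ≤ K → ¬ P i) →
               sumTo K (𝟙 ∘ P?) ≡ 0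
sumTo-𝟙-none K P? ¬P = sumTo-zero K (λ i i≤K → 𝟙-no (P? i) (¬P i i≤K))

sumTo-𝟙-unique : ∀ K {P : ℕ → Set} (P? : Decidable P) w → w ≤ K → P w →
                 (∀ i → i ≤ K → P i → i ≡ w) → sumTo K (𝟙 ∘ P?) ≡ 1
sumTo-𝟙-unique K P? w w≤K Pw unique = begin
  sumTo K (𝟙 ∘ P?)                   ≡⟨ sumTo-cong K P≡w ⟩
  sumTo K (λ i → 𝟙 (i ≟ w) * 1)      ≡⟨ sumTo-𝟙≟-≤ (λ _ → 1) w≤K ⟩
  1                                  ∎
  where
  P≡w : ∀ i → i ≤ K → 𝟙 (P? i) ≡ 𝟙 (i ≟ w) * 1
  P≡w i i≤K = trans (𝟙-cong (P? i) (i ≟ w) (unique i i≤K) (λ { refl → Pw })) (sym (*-identityʳ _))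

-- Each t in the support of F is φ e for exactly one e ≤ K', so both sides
-- equal the double sum of 𝟙 (t ≡ φ e) * F t.
sumTo-reindex : ∀ K K' (F : ℕ → ℕ) (φ : ℕ → ℕ) → (∀ a b → φ a ≡ φ b → a ≡ b) →
                (∀ t → t ≤ K → F t ≢ 0 → ∃ λ e → e ≤ K' × φ e ≡ t) →
                (∀ e → e ≤ K' → F (φ e) ≢ 0 → φ e ≤ K) →
                sumTo K F ≡ sumTo K' (F ∘ φ)
sumTo-reindex K K' F φ φ-inj φ-onto φ-into = begin
  sumTo K F
    ≡⟨ sumTo-cong K fiber ⟨
  sumTo K (λ t → sumTo K' (λ e → 𝟙 (t ≟ φ e)) * F t)
    ≡⟨ sumTo-ext K (λ t → sumTo-*ʳ K' (F t) _) ⟨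
  sumTo K (λ t → sumTo K' (λ e → 𝟙 (t ≟ φ e) * F t))
    ≡⟨ sumTo-swap K K' _ ⟩
  sumTo K' (λ e → sumTo K (λ t → 𝟙 (t ≟ φ e) * F t))
    ≡⟨ sumTo-cong K' pick ⟩
  sumTo K' (F ∘ φ) ∎
  where
  fiber : ∀ t → t ≤ K → sumTo K' (λ e → 𝟙 (t ≟ φ e)) * F t ≡ F t
  fiber t t≤K with F t ≟ 0
  ... | yes F≡0 rewrite F≡0 = *-zeroʳ (sumTo K' (λ e → 𝟙 (t ≟ φ e)))
  ... | no  F≢0 with φ-onto t t≤K F≢0
  ... | e , e≤K' , φe≡t = trans (cong (_* F t) one) (*-identityˡ (F t))
    where
    one : sumTo K' (λ e → 𝟙 (t ≟ φ e)) ≡ 1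
    one = sumTo-𝟙-unique K' (λ e → t ≟ φ e) e e≤K' (sym φe≡t)
            (λ i _ t≡φi → φ-inj i e (trans (sym t≡φi) (sym φe≡t)))
  pick : ∀ e → e ≤ K' → sumTo K (λ t → 𝟙 (t ≟ φ e) * F t) ≡ F (φ e)
  pick e e≤K' with F (φ e) ≟ 0
  ... | yes F≡0 = trans (sumTo-𝟙≟ K (φ e) F)
                        (trans (cong (𝟙 (φ e ≤? K) *_) F≡0) (trans (*-zeroʳ (𝟙 (φ e ≤? K))) (sym F≡0)))
  ... | no  F≢0 = sumTo-𝟙≟-≤ F (φ-into e e≤K' F≢0)

sumTo-𝟙<-shift : ∀ m j (G : ℕ → ℕ) → (∀ n → m < n → G n ≡ 0) →
                 sumTo m (λ n → 𝟙 (j <? n) * G n) ≡ sumTo m (λ e → G (suc (j + e)))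
sumTo-𝟙<-shift m j G G-vanishes = trans (sumTo-reindex m m F φ φ-inj onto into) (sumTo-ext m F∘φ≡G∘φ)
  where
  F : ℕ → ℕ
  F n = 𝟙 (j <? n) * G n
  φ : ℕ → ℕ
  φ e = suc (j + e)
  φ-inj : ∀ a b → φ a ≡ φ b → a ≡ b
  φ-inj a b eq = +-cancelˡ-≡ j a b (suc-injective eq)
  onto : ∀ n → n ≤ m → F n ≢ 0 → ∃ λ e → e ≤ m × φ e ≡ n
  onto n n≤m F≢0 with j <? n
  ... | yes j<n = n ∸ suc j , ≤-trans (m∸n≤m n (suc j)) n≤m , m+[n∸m]≡n j<n
  ... | no  j≮n = contradiction (cong (_* G n) (𝟙-no (j <? n) j≮n)) F≢0
  into : ∀ e → e ≤ m → F (φ e) ≢ 0 → φ e ≤ m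
  into e _ F≢0 with φ e ≤? m
  ... | yes φe≤m = φe≤m
  ... | no  φe≰m = contradiction (trans (cong (𝟙 (j <? φ e) *_) (G-vanishes (φ e) (≰⇒> φe≰m)))
                                        (*-zeroʳ (𝟙 (j <? φ e))))
                                 F≢0
  F∘φ≡G∘φ : ∀ e → F (φ e) ≡ G (φ e)
  F∘φ≡G∘φ e = trans (cong (_* G (φ e)) (𝟙-yes (j <? φ e) (s≤s (m≤m+n j e)))) (+-identityʳ (G (φ e)))

sumBelow : ℕ → (ℕ → ℕ) → ℕ
sumBelow zero    f = 0
sumBelow (suc n) f = sumBelow n f + f n

sumBelow-as-sumTo : ∀ n K (f : ℕ → ℕ) → n ≤ suc K →
                    sumBelow n f ≡ sumTo K (λ j → 𝟙 (j <? n) * f j)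
sumBelow-as-sumTo zero    K f _       = sym (sumTo-zero K (λ _ _ → refl))
sumBelow-as-sumTo (suc n) K f 1+n≤1+K = begin
  sumBelow n f + f n
    ≡⟨ cong₂ _+_ (sumBelow-as-sumTo n K f (m≤n⇒m≤1+n n≤K)) (sym (sumTo-𝟙≟-≤ f n≤K)) ⟩
  sumTo K (λ j → 𝟙 (j <? n) * f j) + sumTo K (λ j → 𝟙 (j ≟ n) * f j)
    ≡⟨ sumTo-+ K _ _ ⟨
  sumTo K (λ j → 𝟙 (j <? n) * f j + 𝟙 (j ≟ n) * f j)
    ≡⟨ sumTo-ext K (λ j → trans (sym (*-distribʳ-+ (f j) (𝟙 (j <? n)) _))
                                (cong (_* f j) (sym (𝟙<-suc j n)))) ⟩
  sumTo K (λ j → 𝟙 (j <? suc n) * f j) ∎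
  where n≤K = ≤-pred 1+n≤1+K

sumTo² : ℕ → (ℕ → ℕ → ℕ) → ℕ
sumTo² K F = sumTo K (λ i → sumTo K (F i))

sumTo⁴ : ℕ → (ℕ → ℕ → ℕ → ℕ → ℕ) → ℕ
sumTo⁴ K F = sumTo² K (λ a b → sumTo² K (F a b))

sumTo²-+ : ∀ K (F G : ℕ → ℕ → ℕ) → sumTo² K (λ i j → F i j + G i j) ≡ sumTo² K F + sumTo² K G
sumTo²-+ K F G = trans (sumTo-ext K (λ i → sumTo-+ K (F i) (G i))) (sumTo-+ K _ _)

sumTo²-symmetric : ∀ K (F : ℕ → ℕ → ℕ) → (∀ i j → F i j ≡ F j i) →
                   sumTo² K F ≡ sumTo K (λ i → F i i) + 2 * sumTo² K (λ i j → 𝟙 (i <? j) * F i j)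
sumTo²-symmetric K F F-sym = begin
  sumTo² K F
    ≡⟨ sumTo-ext K (λ i → sumTo-ext K (split i)) ⟩
  sumTo² K (λ i j → Upper i j + Diag i j + Lower i j)
    ≡⟨ trans (sumTo²-+ K _ Lower) (cong (_+ sumTo² K Lower) (sumTo²-+ K Upper Diag)) ⟩
  sumTo² K Upper + sumTo² K Diag + sumTo² K Lower
    ≡⟨ cong₂ (λ x y → sumTo² K Upper + x + y) diagonal lower≡upper ⟩
  sumTo² K Upper + sumTo K (λ i → F i i) + sumTo² K Upper
    ≡⟨ regroup (sumTo² K Upper) _ ⟩
  sumTo K (λ i → F i i) + 2 * sumTo² K Upper ∎
  where
  Upper Diag Lower : ℕ → ℕ → ℕ
  Upper i j = 𝟙 (i <? j) * F i j
  Diag  i j = 𝟙 (j ≟ i) * F i j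
  Lower i j = 𝟙 (j <? i) * F i j
  split : ∀ i j → F i j ≡ Upper i j + Diag i j + Lower i j
  split i j = begin
    F i j
      ≡⟨ *-identityˡ (F i j) ⟨
    1 * F i j
      ≡⟨ cong (_* F i j) (𝟙-trichotomy i j) ⟨
    (𝟙 (i <? j) + 𝟙 (j ≟ i) + 𝟙 (j <? i)) * F i j
      ≡⟨ *-distribʳ-+ (F i j) (𝟙 (i <? j) + 𝟙 (j ≟ i)) _ ⟩
    (𝟙 (i <? j) + 𝟙 (j ≟ i)) * F i j + Lower i j
      ≡⟨ cong (_+ Lower i j) (*-distribʳ-+ (F i j) (𝟙 (i <? j)) (𝟙 (j ≟ i))) ⟩
    Upper i j + Diag i j + Lower i j ∎
  diagonal : sumTo² K Diag ≡ sumTo K (λ i → F i i)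
  diagonal = sumTo-cong K (λ i i≤K → sumTo-𝟙≟-≤ (F i) i≤K)
  lower≡upper : sumTo² K Lower ≡ sumTo² K Upper
  lower≡upper = trans (sumTo-swap K K Lower)
                      (sumTo-ext K (λ i → sumTo-ext K (λ j → cong (𝟙 (i <? j) *_) (F-sym j i))))
  regroup : ∀ u d → u + d + u ≡ d + 2 * u
  regroup = solve-∀

sumTo⁴-reversal : ∀ K (F : ℕ → ℕ → ℕ → ℕ → ℕ) → (∀ a b c d → F a b c d ≡ F d c b a) →
                  ∃ λ X → sumTo⁴ K F ≡ sumTo² K (λ a b → F a b b a) + 2 * X
sumTo⁴-reversal K F F-rev = X₁ + sumTo K X₂ , (begin
  sumTo⁴ K F
    ≡⟨ sumTo-ext K (λ a → trans (sumTo-ext K (λ b → sumTo-swap K K (F a b))) (sumTo-swap K K _)) ⟩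
  sumTo² K G
    ≡⟨ sumTo²-symmetric K G G-sym ⟩
  sumTo K (λ a → G a a) + 2 * X₁
    ≡⟨ cong (_+ 2 * X₁) (sumTo-ext K inner) ⟩
  sumTo K (λ a → sumTo K (λ b → F a b b a) + 2 * X₂ a) + 2 * X₁
    ≡⟨ cong (_+ 2 * X₁) (trans (sumTo-+ K _ _) (cong (Fixed +_) (sumTo-*ˡ K 2 X₂))) ⟩
  Fixed + 2 * sumTo K X₂ + 2 * X₁
    ≡⟨ regroup Fixed (sumTo K X₂) X₁ ⟩
  Fixed + 2 * (X₁ + sumTo K X₂) ∎)
  where
  G : ℕ → ℕ → ℕ
  G a d = sumTo² K (λ b c → F a b c d)
  G-sym : ∀ a d → G a d ≡ G d a
  G-sym a d = trans (sumTo-swap K K _) (sumTo-ext K (λ c → sumTo-ext K (λ b → F-rev a b c d)))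
  X₁ : ℕ
  X₁ = sumTo² K (λ i j → 𝟙 (i <? j) * G i j)
  X₂ : ℕ → ℕ
  X₂ a = sumTo² K (λ i j → 𝟙 (i <? j) * F a i j a)
  inner : ∀ a → G a a ≡ sumTo K (λ b → F a b b a) + 2 * X₂ a
  inner a = sumTo²-symmetric K (λ b c → F a b c a) (λ b c → F-rev a b c a)
  Fixed : ℕ
  Fixed = sumTo² K (λ a b → F a b b a)
  regroup : ∀ z x y → z + 2 * x + 2 * y ≡ z + 2 * (y + x)
  regroup = solve-∀

-- Formal power series

_⊕_ : Ser → Ser → Ser
(f ⊕ g) n = f n + g n

_·_ : ℕ → Ser → Ser
(c · f) n = c * f n

⊛-cong : ∀ {f f' g g' : Ser} → f ≗ f' → g ≗ g' → f ⊛ g ≗ f' ⊛ g'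
⊛-cong f≗f' g≗g' n = sumTo-ext n (λ i → cong₂ _*_ (f≗f' i) (g≗g' (n ∸ i)))

⊛-comm : ∀ (f g : Ser) → f ⊛ g ≗ g ⊛ f
⊛-comm f g n = begin
  sumTo n (λ i → f i * g (n ∸ i))               ≡⟨ sumTo-reverse n _ ⟩
  sumTo n (λ i → f (n ∸ i) * g (n ∸ (n ∸ i)))   ≡⟨ sumTo-cong n swap ⟩
  sumTo n (λ i → g i * f (n ∸ i))               ∎
  where
  swap : ∀ i → i ≤ n → f (n ∸ i) * g (n ∸ (n ∸ i)) ≡ g i * f (n ∸ i)
  swap i i≤n = trans (cong (λ x → f (n ∸ i) * g x) (m∸[m∸n]≡n i≤n)) (*-comm (f (n ∸ i)) (g i))

⊛-assoc : ∀ (f g h : Ser) → (f ⊛ g) ⊛ h ≗ f ⊛ (g ⊛ h)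
⊛-assoc f g h n = begin
  sumTo n (λ i → sumTo i (λ a → f a * g (i ∸ a)) * h (n ∸ i))
    ≡⟨ sumTo-ext n (λ i → sumTo-*ʳ i (h (n ∸ i)) _) ⟨
  sumTo n (λ i → sumTo i (λ a → f a * g (i ∸ a) * h (n ∸ i)))
    ≡⟨ sumTo-triangle n (λ a i → f a * g (i ∸ a) * h (n ∸ i)) ⟩
  sumTo n (λ a → sumTo (n ∸ a) (λ k → f a * g (a + k ∸ a) * h (n ∸ (a + k))))
    ≡⟨ sumTo-ext n (λ a → trans (sumTo-ext (n ∸ a) (reshape a)) (sumTo-*ˡ (n ∸ a) (f a) _)) ⟩
  sumTo n (λ a → f a * sumTo (n ∸ a) (λ k → g k * h (n ∸ a ∸ k))) ∎
  where
  reshape : ∀ a k → f a * g (a + k ∸ a) * h (n ∸ (a + k)) ≡ f a * (g k * h (n ∸ a ∸ k))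
  reshape a k = trans (cong₂ (λ x y → f a * g x * h y) (m+n∸m≡n a k) (sym (∸-+-assoc n a k)))
                      (*-assoc (f a) _ _)

⊛-interchange : ∀ (f g h k : Ser) → (f ⊛ g) ⊛ (h ⊛ k) ≗ (f ⊛ h) ⊛ (g ⊛ k)
⊛-interchange f g h k n = begin
  ((f ⊛ g) ⊛ (h ⊛ k)) n    ≡⟨ ⊛-assoc f g (h ⊛ k) n ⟩
  (f ⊛ (g ⊛ (h ⊛ k))) n    ≡⟨ ⊛-cong {f} {f} (λ _ → refl) g⊛[h⊛k] n ⟩
  (f ⊛ (h ⊛ (g ⊛ k))) n    ≡⟨ ⊛-assoc f h (g ⊛ k) n ⟨
  ((f ⊛ h) ⊛ (g ⊛ k)) n    ∎
  where
  g⊛[h⊛k] : g ⊛ (h ⊛ k) ≗ h ⊛ (g ⊛ k)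
  g⊛[h⊛k] i = trans (sym (⊛-assoc g h k i))
                    (trans (⊛-cong {g ⊛ h} {h ⊛ g} {k} {k} (⊛-comm g h) (λ _ → refl) i) (⊛-assoc h g k i))

⊛-distribʳ-⊕ : ∀ (f g h : Ser) → (f ⊕ g) ⊛ h ≗ (f ⊛ h) ⊕ (g ⊛ h)
⊛-distribʳ-⊕ f g h n =
  trans (sumTo-ext n (λ i → *-distribʳ-+ (h (n ∸ i)) (f i) (g i))) (sumTo-+ n _ _)

⊛-distribˡ-⊕ : ∀ (f g h : Ser) → h ⊛ (f ⊕ g) ≗ (h ⊛ f) ⊕ (h ⊛ g)
⊛-distribˡ-⊕ f g h n =
  trans (⊛-comm h (f ⊕ g) n) (trans (⊛-distribʳ-⊕ f g h n) (cong₂ _+_ (⊛-comm f h n) (⊛-comm g h n)))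

·-⊛ : ∀ c (f g : Ser) → (c · f) ⊛ g ≗ c · (f ⊛ g)
·-⊛ c f g n = trans (sumTo-ext n (λ i → *-assoc c (f i) _)) (sumTo-*ˡ n c _)

⊛-· : ∀ c (f g : Ser) → f ⊛ (c · g) ≗ c · (f ⊛ g)
⊛-· c f g n = trans (⊛-comm f (c · g) n) (trans (·-⊛ c g f n) (cong (c *_) (⊛-comm g f n)))

monoS-⊛ : ∀ m (f : Ser) n → (monoS m ⊛ f) n ≡ 𝟙 (m ≤? n) * f (n ∸ m)
monoS-⊛ m f n = sumTo-𝟙≟ n m (λ i → f (n ∸ i))

monoS-⊛-≤ : ∀ {m n} (f : Ser) → m ≤ n → (monoS m ⊛ f) n ≡ f (n ∸ m)
monoS-⊛-≤ {m} {n} f m≤n = sumTo-𝟙≟-≤ (λ i → f (n ∸ i)) m≤n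

oneS-⊛ : ∀ (f : Ser) → oneS ⊛ f ≗ f
oneS-⊛ f n = monoS-⊛-≤ f z≤n

⊛-oneS : ∀ (f : Ser) → f ⊛ oneS ≗ f
⊛-oneS f n = trans (⊛-comm f oneS n) (oneS-⊛ f n)

module _ {d : ℕ} .{{_ : NonZero d}} where

  +-cong-% : ∀ {a a' b b'} → a % d ≡ a' % d → b % d ≡ b' % d → (a + b) % d ≡ (a' + b') % d
  +-cong-% {a} {a'} {b} {b'} a≡a' b≡b' = begin
    (a + b) % d                    ≡⟨ %-distribˡ-+ a b d ⟩
    (a % d + b % d) % d            ≡⟨ cong₂ (λ x y → (x + y) % d) a≡a' b≡b' ⟩
    (a' % d + b' % d) % d          ≡⟨ %-distribˡ-+ a' b' d ⟨
    (a' + b') % d                  ∎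

  *-cong-% : ∀ {a a' b b'} → a % d ≡ a' % d → b % d ≡ b' % d → (a * b) % d ≡ (a' * b') % d
  *-cong-% {a} {a'} {b} {b'} a≡a' b≡b' = begin
    (a * b) % d                    ≡⟨ %-distribˡ-* a b d ⟩
    (a % d * (b % d)) % d          ≡⟨ cong₂ (λ x y → (x * y) % d) a≡a' b≡b' ⟩
    (a' % d * (b' % d)) % d        ≡⟨ %-distribˡ-* a' b' d ⟨
    (a' * b') % d                  ∎

  sumTo-cong-% : ∀ n {f g : ℕ → ℕ} → (∀ i → i ≤ n → f i % d ≡ g i % d) →
                 sumTo n f % d ≡ sumTo n g % d
  sumTo-cong-% zero    f≡g = f≡g 0 z≤n
  sumTo-cong-% (suc n) f≡g =
    +-cong-% (sumTo-cong-% n (λ i i≤n → f≡g i (m≤n⇒m≤1+n i≤n))) (f≡g (suc n) ≤-refl)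

  ⊛-cong-% : ∀ {f f' g g' : Ser} → (∀ i → f i % d ≡ f' i % d) → (∀ i → g i % d ≡ g' i % d) →
             ∀ n → (f ⊛ g) n % d ≡ (f' ⊛ g') n % d
  ⊛-cong-% f≡f' g≡g' n = sumTo-cong-% n (λ i _ → *-cong-% (f≡f' i) (g≡g' (n ∸ i)))

-- B(q) modulo 4

-- q^(2j+1) / (1 − q^(2j+1))
geoOdd⁺ : ℕ → Ser
geoOdd⁺ j zero    = 0
geoOdd⁺ j (suc k) = geoOdd j (suc k)

geoOdd⁺Sum : ℕ → Ser
geoOdd⁺Sum n k = sumBelow n (λ j → geoOdd⁺ j k)

ratioOdd : ℕ → Ser
ratioOdd n = prodS n onePlusOdd ⊛ prodS n geoOdd

multiples-shift : ∀ a .{{_ : NonZero a}} k →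
                  𝟙 (a ≤? suc k) * 𝟙 ((suc k ∸ a) % a ≟ 0) ≡ 𝟙 (suc k % a ≟ 0)
multiples-shift a k with a ≤? suc k
... | yes a≤1+k = trans (cong (_* 𝟙 ((suc k ∸ a) % a ≟ 0)) (𝟙-yes (a ≤? suc k) a≤1+k))
                        (trans (+-identityʳ _) (cong (λ x → 𝟙 (x ≟ 0)) (m≤n⇒[n∸m]%m≡n%m a≤1+k)))
... | no  a≰1+k = trans (cong (_* 𝟙 ((suc k ∸ a) % a ≟ 0)) (𝟙-no (a ≤? suc k) a≰1+k))
                        (sym (𝟙-no (suc k % a ≟ 0) (λ a∣1+k → 0≢1+n (trans (sym a∣1+k) 1+k%a≡1+k))))
  where 1+k%a≡1+k = m<n⇒m%n≡m (≰⇒> a≰1+k)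

onePlusOdd⊛geoOdd : ∀ j → onePlusOdd j ⊛ geoOdd j ≗ oneS ⊕ (2 · geoOdd⁺ j)
onePlusOdd⊛geoOdd j zero    = refl
onePlusOdd⊛geoOdd j (suc k) = begin
  (onePlusOdd j ⊛ geoOdd j) (suc k)
    ≡⟨ ⊛-distribʳ-⊕ oneS (monoS (suc (2 * j))) (geoOdd j) (suc k) ⟩
  (oneS ⊛ geoOdd j) (suc k) + (monoS (suc (2 * j)) ⊛ geoOdd j) (suc k)
    ≡⟨ cong₂ _+_ (oneS-⊛ (geoOdd j) (suc k))
                 (trans (monoS-⊛ (suc (2 * j)) (geoOdd j) (suc k)) (multiples-shift (suc (2 * j)) k)) ⟩
  geoOdd j (suc k) + geoOdd j (suc k)
    ≡⟨ cong (geoOdd j (suc k) +_) (+-identityʳ _) ⟨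
  2 * geoOdd j (suc k) ∎

[1+2f]⊛[1+2g]%4 : ∀ (f g : Ser) k →
                  ((oneS ⊕ (2 · f)) ⊛ (oneS ⊕ (2 · g))) k % 4 ≡ (oneS k + 2 * (f k + g k)) % 4
[1+2f]⊛[1+2g]%4 f g k =
  trans (cong (_% 4) expand) ([m+kn]%n≡m%n (oneS k + 2 * (f k + g k)) ((f ⊛ g) k) 4)
  where
  regroup : ∀ a x y z → (a + 2 * x) + (2 * y + 2 * (2 * z)) ≡ (a + 2 * (y + x)) + z * 4
  regroup = solve-∀
  expand : ((oneS ⊕ (2 · f)) ⊛ (oneS ⊕ (2 · g))) k ≡ oneS k + 2 * (f k + g k) + (f ⊛ g) k * 4
  expand = begin
    ((oneS ⊕ (2 · f)) ⊛ (oneS ⊕ (2 · g))) k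
      ≡⟨ ⊛-distribʳ-⊕ oneS (2 · f) (oneS ⊕ (2 · g)) k ⟩
    (oneS ⊛ (oneS ⊕ (2 · g))) k + ((2 · f) ⊛ (oneS ⊕ (2 · g))) k
      ≡⟨ cong₂ _+_ (oneS-⊛ (oneS ⊕ (2 · g)) k)
                   (trans (·-⊛ 2 f (oneS ⊕ (2 · g)) k) (cong (2 *_) (⊛-distribˡ-⊕ oneS (2 · g) f k))) ⟩
    (oneS k + 2 * g k) + 2 * ((f ⊛ oneS) k + (f ⊛ (2 · g)) k)
      ≡⟨ cong ((oneS k + 2 * g k) +_) (*-distribˡ-+ 2 ((f ⊛ oneS) k) _) ⟩
    (oneS k + 2 * g k) + (2 * (f ⊛ oneS) k + 2 * (f ⊛ (2 · g)) k)
      ≡⟨ cong₂ (λ x y → (oneS k + 2 * g k) + (2 * x + 2 * y)) (⊛-oneS f k) (⊛-· 2 f g k) ⟩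
    (oneS k + 2 * g k) + (2 * f k + 2 * (2 * (f ⊛ g) k))
      ≡⟨ regroup (oneS k) (g k) (f k) ((f ⊛ g) k) ⟩
    oneS k + 2 * (f k + g k) + (f ⊛ g) k * 4 ∎

ratioOdd-%4 : ∀ n k → ratioOdd n k % 4 ≡ (oneS k + 2 * geoOdd⁺Sum n k) % 4
ratioOdd-%4 zero    k = cong (_% 4) (trans (oneS-⊛ oneS k) (sym (+-identityʳ (oneS k))))
ratioOdd-%4 (suc n) k = begin
  ratioOdd (suc n) k % 4
    ≡⟨ cong (_% 4) (⊛-interchange (prodS n onePlusOdd) (onePlusOdd n) (prodS n geoOdd) (geoOdd n) k) ⟩
  (ratioOdd n ⊛ (onePlusOdd n ⊛ geoOdd n)) k % 4
    ≡⟨ ⊛-cong-% {f = ratioOdd n} {1+2H} {onePlusOdd n ⊛ geoOdd n} {1+2h}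
                (ratioOdd-%4 n) (λ i → cong (_% 4) (onePlusOdd⊛geoOdd n i)) k ⟩
  (1+2H ⊛ 1+2h) k % 4
    ≡⟨ [1+2f]⊛[1+2g]%4 (geoOdd⁺Sum n) (geoOdd⁺ n) k ⟩
  (oneS k + 2 * geoOdd⁺Sum (suc n) k) % 4 ∎
  where
  1+2H 1+2h : Ser
  1+2H = oneS ⊕ (2 · geoOdd⁺Sum n)
  1+2h = oneS ⊕ (2 · geoOdd⁺ n)

geoOdd⁺Sum-⊛ : ∀ n (g : Ser) r → (geoOdd⁺Sum n ⊛ g) r ≡ sumBelow n (λ j → (geoOdd⁺ j ⊛ g) r)
geoOdd⁺Sum-⊛ zero    g r = sumTo-zero r (λ _ _ → refl)
geoOdd⁺Sum-⊛ (suc n) g r = trans (⊛-distribʳ-⊕ (geoOdd⁺Sum n) (geoOdd⁺ n) g r)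
                                 (cong (_+ (geoOdd⁺ n ⊛ g) r) (geoOdd⁺Sum-⊛ n g r))

termB-%4 : ∀ {n m} → n ≤ m →
           termB n m % 4 ≡ (geoOdd n (m ∸ n) + 2 * sumBelow n (λ j → (geoOdd⁺ j ⊛ geoOdd n) (m ∸ n))) % 4
termB-%4 {n} {m} n≤m = begin
  termB n m % 4
    ≡⟨ cong (_% 4) (trans (monoS-⊛-≤ (prodS n onePlusOdd ⊛ prodS (suc n) geoOdd) n≤m)
                          (sym (⊛-assoc (prodS n onePlusOdd) (prodS n geoOdd) (geoOdd n) r))) ⟩
  (ratioOdd n ⊛ geoOdd n) r % 4
    ≡⟨ ⊛-cong-% {f = ratioOdd n} {1+2H} {geoOdd n} {geoOdd n} (ratioOdd-%4 n) (λ _ → refl) r ⟩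
  (1+2H ⊛ geoOdd n) r % 4
    ≡⟨ cong (_% 4) (⊛-distribʳ-⊕ oneS (2 · geoOdd⁺Sum n) (geoOdd n) r) ⟩
  ((oneS ⊛ geoOdd n) r + ((2 · geoOdd⁺Sum n) ⊛ geoOdd n) r) % 4
    ≡⟨ cong (_% 4) (cong₂ _+_ (oneS-⊛ (geoOdd n) r) (·-⊛ 2 (geoOdd⁺Sum n) (geoOdd n) r)) ⟩
  (geoOdd n r + 2 * (geoOdd⁺Sum n ⊛ geoOdd n) r) % 4
    ≡⟨ cong (λ x → (geoOdd n r + 2 * x) % 4) (geoOdd⁺Sum-⊛ n (geoOdd n) r) ⟩
  (geoOdd n r + 2 * sumBelow n (λ j → (geoOdd⁺ j ⊛ geoOdd n) r)) % 4 ∎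
  where
  r = m ∸ n
  1+2H : Ser
  1+2H = oneS ⊕ (2 · geoOdd⁺Sum n)

-- Coefficients as numbers of solutions

odd-injective : ∀ {x y} → suc (2 * x) ≡ suc (2 * y) → x ≡ y
odd-injective {x} {y} eq = *-cancelˡ-≡ x y 2 (suc-injective eq)

𝟙-odd : ∀ x y → 𝟙 (x ≟ y) ≡ 𝟙 (suc (2 * x) ≟ suc (2 * y))
𝟙-odd x y = 𝟙-cong (x ≟ y) (suc (2 * x) ≟ suc (2 * y)) (cong (λ z → suc (2 * z))) odd-injective

𝟙-≟∸ : ∀ {m n} x → n ≤ m → 𝟙 (x ≟ m ∸ n) ≡ 𝟙 (n + x ≟ m)
𝟙-≟∸ {m} {n} x n≤m = 𝟙-cong (x ≟ m ∸ n) (n + x ≟ m)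
  (λ x≡m∸n → trans (cong (n +_) x≡m∸n) (m+[n∸m]≡n n≤m))
  (λ n+x≡m → trans (sym (m+n∸m≡n n x)) (cong (_∸ n) n+x≡m))

𝟙≤?*𝟙≟∸ : ∀ x y r → 𝟙 (x ≤? r) * 𝟙 (y ≟ r ∸ x) ≡ 𝟙 (x + y ≟ r)
𝟙≤?*𝟙≟∸ x y r with x ≤? r
... | yes x≤r = trans (cong (_* 𝟙 (y ≟ r ∸ x)) (𝟙-yes (x ≤? r) x≤r))
                      (trans (+-identityʳ _) (𝟙-≟∸ y x≤r))
... | no  x≰r = trans (cong (_* 𝟙 (y ≟ r ∸ x)) (𝟙-no (x ≤? r) x≰r))
                      (sym (𝟙-no (x + y ≟ r) (λ x+y≡r → x≰r (≤-trans (m≤m+n x y) (≤-reflexive x+y≡r)))))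

𝟙-%≡0-count : ∀ a .{{_ : NonZero a}} K y → y ≤ K →
              𝟙 (y % a ≟ 0) ≡ sumTo K (λ t → 𝟙 (a * t ≟ y))
𝟙-%≡0-count a K y y≤K with y % a ≟ 0
... | yes y%a≡0 = trans (𝟙-yes (y % a ≟ 0) y%a≡0)
  (sym (sumTo-𝟙-unique K (λ t → a * t ≟ y) (y / a) (≤-trans (m/n≤m y a) y≤K) a[y/a]≡y
         (λ t _ at≡y → *-cancelˡ-≡ t (y / a) a (trans at≡y (sym a[y/a]≡y)))))
  where a[y/a]≡y = m*[n/m]≡n (m%n≡0⇒n∣m y a y%a≡0)
... | no  y%a≢0 = trans (𝟙-no (y % a ≟ 0) y%a≢0)
  (sym (sumTo-𝟙-none K (λ t → a * t ≟ y)
         (λ t _ at≡y → y%a≢0 (trans (cong (_% a) (trans (sym at≡y) (*-comm a t))) (m*n%n≡0 t a)))))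

geoOdd-count : ∀ n K y → y ≤ K → geoOdd n y ≡ sumTo K (λ t → 𝟙 (suc (2 * n) * t ≟ y))
geoOdd-count n = 𝟙-%≡0-count (suc (2 * n))

geoOdd⁺-count : ∀ j K i → i ≤ K → geoOdd⁺ j i ≡ sumTo K (λ s → 𝟙 (suc (2 * j) * suc s ≟ i))
geoOdd⁺-count j K zero    _     = sym (sumTo-𝟙-none K (λ s → suc (2 * j) * suc s ≟ 0) (λ _ _ ()))
geoOdd⁺-count j K (suc i) 1+i≤K =
  trans (geoOdd-count j K (suc i) 1+i≤K) (sumTo-reindex K K F suc (λ _ _ → suc-injective) onto into)
  where
  a = suc (2 * j)
  F : ℕ → ℕ
  F t = 𝟙 (a * t ≟ suc i)
  onto : ∀ t → t ≤ K → F t ≢ 0 → ∃ λ e → e ≤ K × suc e ≡ t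
  onto zero    _     F≢0 = contradiction (trans (sym (*-zeroʳ a)) (𝟙-toWitness (a * 0 ≟ suc i) F≢0)) 0≢1+n
  onto (suc t) 1+t≤K _   = t , ≤-trans (n≤1+n t) 1+t≤K , refl
  into : ∀ e → e ≤ K → F (suc e) ≢ 0 → suc e ≤ K
  into e _ F≢0 =
    ≤-trans (m≤n*m (suc e) a) (≤-trans (≤-reflexive (𝟙-toWitness (a * suc e ≟ suc i) F≢0)) 1+i≤K)

⊛-count : ∀ (f g : Ser) (u v : ℕ → ℕ) K r → r ≤ K →
          (∀ i → i ≤ r → f i ≡ sumTo K (λ s → 𝟙 (u s ≟ i))) →
          (∀ i → i ≤ r → g i ≡ sumTo K (λ t → 𝟙 (v t ≟ i))) →
          (f ⊛ g) r ≡ sumTo² K (λ s t → 𝟙 (u s + v t ≟ r))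
⊛-count f g u v K r r≤K f-count g-count = begin
  sumTo r (λ i → f i * g (r ∸ i))
    ≡⟨ sumTo-cong r (λ i i≤r → cong₂ _*_ (f-count i i≤r) (g-count (r ∸ i) (m∸n≤m r i))) ⟩
  sumTo r (λ i → sumTo K (λ s → 𝟙 (u s ≟ i)) * sumTo K (λ t → 𝟙 (v t ≟ r ∸ i)))
    ≡⟨ sumTo-ext r (λ i → trans (sym (sumTo-*ʳ K _ _))
                                (sumTo-ext K (λ s → sym (sumTo-*ˡ K (𝟙 (u s ≟ i)) _)))) ⟩
  sumTo r (λ i → sumTo² K (λ s t → 𝟙 (u s ≟ i) * 𝟙 (v t ≟ r ∸ i)))
    ≡⟨ trans (sumTo-swap r K _) (sumTo-ext K (λ s → sumTo-swap r K _)) ⟩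
  sumTo² K (λ s t → sumTo r (λ i → 𝟙 (u s ≟ i) * 𝟙 (v t ≟ r ∸ i)))
    ≡⟨ sumTo-ext K (λ s → sumTo-ext K (λ t → trans (sumTo-ext r (flip s t)) (sumTo-𝟙≟ r (u s) _))) ⟩
  sumTo² K (λ s t → 𝟙 (u s ≤? r) * 𝟙 (v t ≟ r ∸ u s))
    ≡⟨ sumTo-ext K (λ s → sumTo-ext K (λ t → 𝟙≤?*𝟙≟∸ (u s) (v t) r)) ⟩
  sumTo² K (λ s t → 𝟙 (u s + v t ≟ r)) ∎
  where
  flip : ∀ s t i → 𝟙 (u s ≟ i) * 𝟙 (v t ≟ r ∸ i) ≡ 𝟙 (i ≟ u s) * 𝟙 (v t ≟ r ∸ i)
  flip s t i = cong (_* 𝟙 (v t ≟ r ∸ i)) (𝟙-cong (u s ≟ i) (i ≟ u s) sym sym)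

divisorPair : ℕ → ℕ → ℕ → ℕ
divisorPair m i j = 𝟙 (suc (2 * i) * suc (2 * j) ≟ suc (2 * m))

geoOdd-antidiagonal-count : ∀ m → sumTo m (λ n → geoOdd n (m ∸ n)) ≡ sumTo² m (divisorPair m)
geoOdd-antidiagonal-count m = sumTo-cong m (λ n n≤m →
  trans (geoOdd-count n m (m ∸ n) (m∸n≤m m n)) (sumTo-ext m (λ t → row n≤m t)))
  where
  odd*odd : ∀ n t → suc (2 * n) * suc (2 * t) ≡ suc (2 * (n + suc (2 * n) * t))
  odd*odd = solve-∀
  row : ∀ {n} → n ≤ m → ∀ t → 𝟙 (suc (2 * n) * t ≟ m ∸ n) ≡ divisorPair m n t
  row {n} n≤m t = begin
    𝟙 (suc (2 * n) * t ≟ m ∸ n)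
      ≡⟨ 𝟙-≟∸ _ n≤m ⟩
    𝟙 (n + suc (2 * n) * t ≟ m)
      ≡⟨ 𝟙-odd (n + suc (2 * n) * t) m ⟩
    𝟙 (suc (2 * (n + suc (2 * n) * t)) ≟ suc (2 * m))
      ≡⟨ cong (λ x → 𝟙 (x ≟ suc (2 * m))) (odd*odd n t) ⟨
    divisorPair m n t ∎

-- With n = j + 1 + e, the exponent condition n + (2j+1)(s+1) + (2n+1)t = m for
-- q^n · q^(2j+1)/(1 − q^(2j+1)) · 1/(1 − q^(2n+1)) reads quadForm j e s t = 2m + 1;
-- quadForm is invariant under (j, e, s, t) ↦ (t, s, e, j).
quadForm : ℕ → ℕ → ℕ → ℕ → ℕ
quadForm j e s t = suc (2 * j) * suc (2 * t) + 2 * (suc e * suc (2 * t)) + 2 * (suc (2 * j) * suc s)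

quadForm-expand : ∀ j e s t →
  quadForm j e s t ≡ suc (2 * (suc (j + e) + (suc (2 * j) * suc s + suc (2 * suc (j + e)) * t)))
quadForm-expand = expand
  where
  expand : ∀ j e s t → suc (2 * j) * suc (2 * t) + 2 * (suc e * suc (2 * t)) + 2 * (suc (2 * j) * suc s)
                     ≡ suc (2 * (suc (j + e) + (suc (2 * j) * suc s + suc (2 * suc (j + e)) * t)))
  expand = solve-∀

quadSol : ℕ → ℕ → ℕ → ℕ → ℕ → ℕ
quadSol m j e s t = 𝟙 (quadForm j e s t ≟ suc (2 * m))

exponentSol : ℕ → ℕ → ℕ → ℕ → ℕ → ℕ
exponentSol m j n s t = 𝟙 (suc (2 * j) * suc s + suc (2 * n) * t ≟ m ∸ n)

exponentSol-beyond : ∀ {m n} j s t → m < n → exponentSol m j n s t ≡ 0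
exponentSol-beyond {m} {n} j s t m<n = 𝟙-no (_ ≟ m ∸ n)
  (λ eq → 0≢1+n (trans (sym (m≤n⇒m∸n≡0 (<⇒≤ m<n))) (sym eq)))

exponentSol≡quadSol : ∀ m j e s t → exponentSol m j (suc (j + e)) s t ≡ quadSol m j e s t
exponentSol≡quadSol m j e s t = by-cases (n ≤? m)
  where
  n = suc (j + e)
  x = suc (2 * j) * suc s + suc (2 * n) * t
  expand : quadForm j e s t ≡ suc (2 * (n + x))
  expand = quadForm-expand j e s t
  by-cases : Dec (n ≤ m) → exponentSol m j n s t ≡ quadSol m j e s t
  by-cases (yes n≤m) = begin
    𝟙 (x ≟ m ∸ n)                          ≡⟨ 𝟙-≟∸ x n≤m ⟩
    𝟙 (n + x ≟ m)                          ≡⟨ 𝟙-odd (n + x) m ⟩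
    𝟙 (suc (2 * (n + x)) ≟ suc (2 * m))    ≡⟨ cong (λ y → 𝟙 (y ≟ suc (2 * m))) expand ⟨
    quadSol m j e s t                      ∎
  by-cases (no n≰m) =
    trans (exponentSol-beyond j s t (≰⇒> n≰m)) (sym (𝟙-no (quadForm j e s t ≟ suc (2 * m)) ¬sol))
    where
    ¬sol : quadForm j e s t ≢ suc (2 * m)
    ¬sol eq = n≰m (≤-trans (m≤m+n n x) (≤-reflexive (odd-injective (trans (sym expand) eq))))

quadSol-count : ∀ m → sumTo m (λ n → sumBelow n (λ j → (geoOdd⁺ j ⊛ geoOdd n) (m ∸ n)))
                      ≡ sumTo⁴ m (quadSol m)
quadSol-count m = begin
  sumTo m (λ n → sumBelow n (λ j → (geoOdd⁺ j ⊛ geoOdd n) (m ∸ n)))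
    ≡⟨ sumTo-cong m (λ n n≤m → trans (sumBelow-as-sumTo n m _ (m≤n⇒m≤1+n n≤m))
                                     (sumTo-ext m (λ j → cong (𝟙 (j <? n) *_) (pair-count n≤m j)))) ⟩
  sumTo m (λ n → sumTo m (λ j → 𝟙 (j <? n) * sumTo² m (exponentSol m j n)))
    ≡⟨ sumTo-swap m m _ ⟩
  sumTo m (λ j → sumTo m (λ n → 𝟙 (j <? n) * sumTo² m (exponentSol m j n)))
    ≡⟨ sumTo-ext m (λ j → sumTo-𝟙<-shift m j _ (λ n m<n →
         sumTo-zero m (λ s _ → sumTo-zero m (λ t _ → exponentSol-beyond j s t m<n)))) ⟩
  sumTo m (λ j → sumTo m (λ e → sumTo² m (exponentSol m j (suc (j + e)))))
    ≡⟨ sumTo-ext m (λ j → sumTo-ext m (λ e →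
         sumTo-ext m (λ s → sumTo-ext m (exponentSol≡quadSol m j e s)))) ⟩
  sumTo⁴ m (quadSol m) ∎
  where
  pair-count : ∀ {n} → n ≤ m → ∀ j → (geoOdd⁺ j ⊛ geoOdd n) (m ∸ n) ≡ sumTo² m (exponentSol m j n)
  pair-count {n} n≤m j =
    ⊛-count (geoOdd⁺ j) (geoOdd n) (λ s → suc (2 * j) * suc s) (λ t → suc (2 * n) * t)
            m (m ∸ n) (m∸n≤m m n)
      (λ i i≤m∸n → geoOdd⁺-count j m i (≤-trans i≤m∸n (m∸n≤m m n)))
      (λ i i≤m∸n → geoOdd-count n m i (≤-trans i≤m∸n (m∸n≤m m n)))

b-%4 : ∀ m → b m % 4 ≡ (sumTo² m (divisorPair m) + 2 * sumTo⁴ m (quadSol m)) % 4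
b-%4 m = begin
  b m % 4
    ≡⟨ sumTo-cong-% m (λ n n≤m → termB-%4 n≤m) ⟩
  sumTo m (λ n → geoOdd n (m ∸ n) + 2 * Pairs n) % 4
    ≡⟨ cong (_% 4) (sumTo-+ m _ _) ⟩
  (sumTo m (λ n → geoOdd n (m ∸ n)) + sumTo m (λ n → 2 * Pairs n)) % 4
    ≡⟨ cong₂ (λ x y → (x + y) % 4) (geoOdd-antidiagonal-count m)
                                   (trans (sumTo-*ˡ m 2 Pairs) (cong (2 *_) (quadSol-count m))) ⟩
  (sumTo² m (divisorPair m) + 2 * sumTo⁴ m (quadSol m)) % 4 ∎
  where
  Pairs : ℕ → ℕ
  Pairs n = sumBelow n (λ j → (geoOdd⁺ j ⊛ geoOdd n) (m ∸ n))

-- Pairing off solutions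

divisorPair-sym : ∀ m i j → divisorPair m i j ≡ divisorPair m j i
divisorPair-sym m i j = cong (λ x → 𝟙 (x ≟ suc (2 * m))) (*-comm (suc (2 * i)) (suc (2 * j)))

quadSol-reversal : ∀ m j e s t → quadSol m j e s t ≡ quadSol m t s e j
quadSol-reversal m j e s t = cong (λ x → 𝟙 (x ≟ suc (2 * m))) (reversal j e s t)
  where
  reversal : ∀ j e s t → suc (2 * j) * suc (2 * t) + 2 * (suc e * suc (2 * t)) + 2 * (suc (2 * j) * suc s)
                       ≡ suc (2 * t) * suc (2 * j) + 2 * (suc s * suc (2 * j)) + 2 * (suc (2 * t) * suc e)
  reversal = solve-∀

quadSol-fixed : ∀ m j e → quadSol m j e e j ≡ divisorPair m j (suc (suc (j + 2 * e)))
quadSol-fixed m j e = cong (λ x → 𝟙 (x ≟ suc (2 * m))) (factorise j e)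
  where
  factorise : ∀ j e → suc (2 * j) * suc (2 * j) + 2 * (suc e * suc (2 * j)) + 2 * (suc (2 * j) * suc e)
                    ≡ suc (2 * j) * suc (2 * suc (suc (j + 2 * e)))
  factorise = solve-∀

even⊎odd : ∀ n → ∃ λ q → n ≡ 2 * q ⊎ n ≡ suc (2 * q)
even⊎odd zero = 0 , inj₁ refl
even⊎odd (suc n) with even⊎odd n
... | q , inj₁ n≡2q   = q , inj₂ (cong suc n≡2q)
... | q , inj₂ n≡2q+1 = suc q , inj₁ (trans (cong suc n≡2q+1) (cong suc (sym (+-suc q (q + 0)))))

odd-factor≤ : ∀ {j t m} → suc (2 * j) * suc (2 * t) ≡ suc (2 * m) → t ≤ m
odd-factor≤ {j} {t} eq =
  *-cancelˡ-≤ 2 (≤-pred (≤-trans (m≤n*m (suc (2 * t)) (suc (2 * j))) (≤-reflexive eq)))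

-- Both factors of a number ≡ 1 (mod 4) are congruent mod 4.
odd-factors-mod4 : ∀ {j t r} → j < t → suc (2 * j) * suc (2 * t) ≡ suc (2 * (2 * r)) →
                   ∃ λ e → t ≡ suc (suc (j + 2 * e))
odd-factors-mod4 {j} {t} {r} j<t eq with even⊎odd (t ∸ suc j)
... | e , inj₂ gap≡2e+1 =
  e , trans (sym (m+[n∸m]≡n j<t)) (trans (cong (λ d → suc (j + d)) gap≡2e+1) (cong suc (+-suc j (2 * e))))
... | q , inj₁ gap≡2q   = contradiction (begin
  3                                                   ≡⟨ [m+kn]%n≡m%n 3 k 4 ⟨
  (3 + k * 4) % 4                                     ≡⟨ cong (_% 4) (≡3+4k j q) ⟨
  (suc (2 * j) * suc (2 * suc (j + 2 * q))) % 4       ≡⟨ cong (λ x → suc (2 * j) * suc (2 * x) % 4) t≡ ⟩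
  (suc (2 * j) * suc (2 * t)) % 4                     ≡⟨ cong (_% 4) eq ⟩
  suc (2 * (2 * r)) % 4                               ≡⟨ cong (_% 4) (≡1+4k r) ⟩
  (1 + r * 4) % 4                                     ≡⟨ [m+kn]%n≡m%n 1 r 4 ⟩
  1                                                   ∎) λ ()
  where
  k = j * j + 2 * j * q + 2 * j + q
  t≡ : suc (j + 2 * q) ≡ t
  t≡ = trans (cong (λ d → suc (j + d)) (sym gap≡2q)) (m+[n∸m]≡n j<t)
  ≡3+4k : ∀ j q → suc (2 * j) * suc (2 * suc (j + 2 * q)) ≡ 3 + (j * j + 2 * j * q + 2 * j + q) * 4
  ≡3+4k = solve-∀
  ≡1+4k : ∀ r → suc (2 * (2 * r)) ≡ 1 + r * 4
  ≡1+4k = solve-∀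

upperDivisorPairs≡quadSolFixedPoints : ∀ r → let m = 2 * r in
  sumTo² m (λ i j → 𝟙 (i <? j) * divisorPair m i j) ≡ sumTo² m (λ j e → quadSol m j e e j)
upperDivisorPairs≡quadSolFixedPoints r = sumTo-ext m row
  where
  m = 2 * r
  row : ∀ j → sumTo m (λ t → 𝟙 (j <? t) * divisorPair m j t) ≡ sumTo m (λ e → quadSol m j e e j)
  row j = trans (sumTo-reindex m m F φ φ-inj onto into) (sumTo-ext m F∘φ≡quadSol)
    where
    F : ℕ → ℕ
    F t = 𝟙 (j <? t) * divisorPair m j t
    φ : ℕ → ℕ
    φ e = suc (suc (j + 2 * e))
    φ-inj : ∀ a b → φ a ≡ φ b → a ≡ b
    φ-inj a b eq = *-cancelˡ-≡ a b 2 (+-cancelˡ-≡ j _ _ (suc-injective (suc-injective eq)))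
    j<φ : ∀ e → j < φ e
    j<φ e = s≤s (≤-trans (m≤m+n j (2 * e)) (n≤1+n _))
    e≤φ : ∀ e → e ≤ φ e
    e≤φ e = ≤-trans (m≤n*m e 2) (≤-trans (m≤n+m (2 * e) j) (≤-trans (n≤1+n _) (n≤1+n _)))
    factor : ∀ t → F t ≢ 0 → suc (2 * j) * suc (2 * t) ≡ suc (2 * m)
    factor t F≢0 = 𝟙-toWitness (suc (2 * j) * suc (2 * t) ≟ suc (2 * m))
                     (λ ≡0 → F≢0 (trans (cong (𝟙 (j <? t) *_) ≡0) (*-zeroʳ (𝟙 (j <? t)))))
    into : ∀ e → e ≤ m → F (φ e) ≢ 0 → φ e ≤ m
    into e _ F≢0 = odd-factor≤ {j} (factor (φ e) F≢0)
    onto : ∀ t → t ≤ m → F t ≢ 0 → ∃ λ e → e ≤ m × φ e ≡ t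
    onto t t≤m F≢0 with j <? t
    ... | no  j≮t = contradiction (cong (_* divisorPair m j t) (𝟙-no (j <? t) j≮t)) F≢0
    ... | yes j<t with odd-factors-mod4 {r = r} j<t (factor t F≢0)
    ...   | e , t≡φe = e , ≤-trans (e≤φ e) (≤-trans (≤-reflexive (sym t≡φe)) t≤m) , sym t≡φe
    F∘φ≡quadSol : ∀ e → F (φ e) ≡ quadSol m j e e j
    F∘φ≡quadSol e = trans (cong (_* divisorPair m j (φ e)) (𝟙-yes (j <? φ e) (j<φ e)))
                          (trans (+-identityʳ _) (sym (quadSol-fixed m j e)))

IsSquare : ℕ → Set
IsSquare n = ∃ λ x → x * x ≡ n

¬square⇒4∣b[2r] : ∀ r → ¬ IsSquare (suc (2 * (2 * r))) → 4 ∣ b (2 * r)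
¬square⇒4∣b[2r] r ¬square with sumTo⁴-reversal (2 * r) (quadSol (2 * r)) (quadSol-reversal (2 * r))
... | X , quadSols≡fixed+2X = m%n≡0⇒n∣m (b m) 4 (begin
  b m % 4                                                    ≡⟨ b-%4 m ⟩
  (sumTo² m (divisorPair m) + 2 * sumTo⁴ m (quadSol m)) % 4
    ≡⟨ cong₂ (λ x y → (x + 2 * y) % 4) divisorPairs≡2Y quadSols≡Y+2X ⟩
  (2 * Y + 2 * (Y + 2 * X)) % 4                              ≡⟨ cong (_% 4) (regroup Y X) ⟩
  (Y + X) * 4 % 4                                            ≡⟨ m*n%n≡0 (Y + X) 4 ⟩
  0                                                          ∎)
  where
  m = 2 * r
  Y = sumTo² m (λ i j → 𝟙 (i <? j) * divisorPair m i j)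
  no-diagonal : ∀ n → n ≤ m → divisorPair m n n ≡ 0
  no-diagonal n _ = 𝟙-no (suc (2 * n) * suc (2 * n) ≟ suc (2 * m)) (λ sq → ¬square (suc (2 * n) , sq))
  divisorPairs≡2Y : sumTo² m (divisorPair m) ≡ 2 * Y
  divisorPairs≡2Y = trans (sumTo²-symmetric m (divisorPair m) (divisorPair-sym m))
                          (cong (_+ 2 * Y) (sumTo-zero m no-diagonal))
  quadSols≡Y+2X : sumTo⁴ m (quadSol m) ≡ Y + 2 * X
  quadSols≡Y+2X = trans quadSols≡fixed+2X (cong (_+ 2 * X) (sym (upperDivisorPairs≡quadSolFixedPoints r)))
  regroup : ∀ y x → 2 * y + 2 * (y + 2 * x) ≡ (y + x) * 4
  regroup = solve-∀

-- Squares and the Legendre symbol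

square-%⇒legendre≢-1 : ∀ a p .{{_ : NonZero p}} y → (y * y) % p ≡ a % p → legendre a p ≢ -[1+ 0 ]
square-%⇒legendre≢-1 a p y y²≡a
  with a % p ≡ᵇ 0 | any (λ x → (x * x) % p ≡ᵇ a % p) (upTo p) in residue
... | true  | _     = λ ()
... | false | true  = λ ()
... | false | false = λ _ → subst T residue (any⁺ _ (lose (∈-upTo⁺ (m%n<n y p)) [y%p]²≡a))
  where
  [y%p]²≡a : T (((y % p) * (y % p)) % p ≡ᵇ a % p)
  [y%p]²≡a = ≡⇒≡ᵇ _ _ (trans (sym (%-distribˡ-* y y p)) y²≡a)

legendre≡-1⇒¬IsSquare : ∀ a k p .{{_ : NonZero p}} → legendre a p ≡ -[1+ 0 ] → ¬ IsSquare (a + k * p)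
legendre≡-1⇒¬IsSquare a k p leg (y , y²≡) =
  square-%⇒legendre≢-1 a p y (trans (cong (_% p) y²≡) ([m+kn]%n≡m%n a k p)) leg

IsSquare-cancel-prime² : ∀ {p Y} → Prime p → IsSquare (p * p * Y) → IsSquare Y
IsSquare-cancel-prime² {p} {Y} pp (x , x²≡ppY) =
  [ root , root ]′ (euclidsLemma x x pp (divides (p * Y) (trans x²≡ppY (reassoc p Y))))
  where
  instance _ = prime⇒nonZero pp
  reassoc : ∀ p Y → p * p * Y ≡ p * Y * p
  reassoc = solve-∀
  square-of-product : ∀ p x' → p * (p * (x' * x')) ≡ x' * p * (x' * p)
  square-of-product = solve-∀
  root : p ∣ x → IsSquare Y
  root (divides x' x≡x'p) = x' , *-cancelˡ-≡ _ _ p (*-cancelˡ-≡ _ _ p (begin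
    p * (p * (x' * x'))   ≡⟨ square-of-product p x' ⟩
    x' * p * (x' * p)     ≡⟨ cong (λ z → z * z) x≡x'p ⟨
    x * x                 ≡⟨ x²≡ppY ⟩
    p * p * Y             ≡⟨ *-assoc p p Y ⟩
    p * (p * Y)           ∎))

IsSquare-cancel-prime-power : ∀ {p Y} → Prime p → ∀ e → IsSquare (p ^ e * p ^ e * Y) → IsSquare Y
IsSquare-cancel-prime-power {p} {Y} pp zero    (x , x²≡Y) = x , trans x²≡Y (+-identityʳ Y)
IsSquare-cancel-prime-power {p} {Y} pp (suc e) (x , x²≡) =
  IsSquare-cancel-prime-power pp e (IsSquare-cancel-prime² pp (x , trans x²≡ (reassoc p (p ^ e) Y)))
  where
  reassoc : ∀ p c Y → p * c * (p * c) * Y ≡ p * p * (c * c * Y)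
  reassoc = solve-∀

Odd : ℕ → Set
Odd c = ∃ λ u → c ≡ suc (2 * u)

prime≢2⇒odd : ∀ {p} → Prime p → p ≢ 2 → Odd p
prime≢2⇒odd {p} pp p≢2 with even⊎odd p
... | u , inj₂ p≡2u+1 = u , p≡2u+1
... | u , inj₁ p≡2u   = contradiction composite (Prime.notComposite pp)
  where
  instance _ = prime⇒nonZero pp
  composite : Composite p
  composite = hasNonTrivialDivisor-≢ {2} (p≢2 ∘ sym) (divides u (trans p≡2u (*-comm 2 u)))

odd-^ : ∀ {c} → Odd c → ∀ e → Odd (c ^ e)
odd-^ _            zero    = 0 , refl
odd-^ (u , c≡2u+1) (suc e) with odd-^ (u , c≡2u+1) e
... | v , cᵉ≡2v+1 = u + v + 2 * u * v , trans (cong₂ _*_ c≡2u+1 cᵉ≡2v+1) (odd*odd u v)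
  where
  odd*odd : ∀ u v → suc (2 * u) * suc (2 * v) ≡ suc (2 * (u + v + 2 * u * v))
  odd*odd = solve-∀

^-double : ∀ p k → p ^ (2 * k + 2) ≡ p ^ suc k * p ^ suc k
^-double p k = trans (cong (p ^_) (2k+2≡[k+1]+[k+1] k)) (^-distribˡ-+-* p (suc k) (suc k))
  where
  2k+2≡[k+1]+[k+1] : ∀ k → 2 * k + 2 ≡ suc k + suc k
  2k+2≡[k+1]+[k+1] = solve-∀

[4ℓ+1]·odd² : ∀ ℓ v → (4 * ℓ + 1) * (suc (2 * v) * suc (2 * v))
                      ≡ suc (2 * (2 * ((4 * ℓ + 1) * (v * v + v) + ℓ)))
[4ℓ+1]·odd² = solve-∀

index≡2[pXn+h] : ∀ p X n ℓ h → (4 * ℓ + 1) * X ≡ suc (2 * (2 * h)) →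
                 2 * (p * X) * n + ((4 * ℓ + 1) * X ∸ 1) / 2 ≡ 2 * (p * X * n + h)
index≡2[pXn+h] p X n ℓ h [4ℓ+1]X≡4h+1 = begin
  2 * (p * X) * n + ((4 * ℓ + 1) * X ∸ 1) / 2
    ≡⟨ cong (λ y → 2 * (p * X) * n + (y ∸ 1) / 2) [4ℓ+1]X≡4h+1 ⟩
  2 * (p * X) * n + (2 * (2 * h)) / 2
    ≡⟨ cong (λ y → 2 * (p * X) * n + y / 2) (*-comm 2 (2 * h)) ⟩
  2 * (p * X) * n + (2 * h * 2) / 2
    ≡⟨ cong (2 * (p * X) * n +_) (m*n/n≡m (2 * h) 2) ⟩
  2 * (p * X) * n + 2 * h
    ≡⟨ factor-2 p X n h ⟩
  2 * (p * X * n + h) ∎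
  where
  factor-2 : ∀ p X n h → 2 * (p * X) * n + 2 * h ≡ 2 * (p * X * n + h)
  factor-2 = solve-∀

4[pXn+h]+1≡X[4ℓ+1+4np] : ∀ p X n ℓ h → (4 * ℓ + 1) * X ≡ suc (2 * (2 * h)) →
                         suc (2 * (2 * (p * X * n + h))) ≡ X * (4 * ℓ + 1 + 4 * n * p)
4[pXn+h]+1≡X[4ℓ+1+4np] p X n ℓ h [4ℓ+1]X≡4h+1 = begin
  suc (2 * (2 * (p * X * n + h)))        ≡⟨ split p X n h ⟩
  4 * (p * X * n) + suc (2 * (2 * h))    ≡⟨ cong (4 * (p * X * n) +_) [4ℓ+1]X≡4h+1 ⟨
  4 * (p * X * n) + (4 * ℓ + 1) * X      ≡⟨ factor-X p X n ℓ ⟩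
  X * (4 * ℓ + 1 + 4 * n * p)            ∎
  where
  split : ∀ p X n h → suc (2 * (2 * (p * X * n + h))) ≡ 4 * (p * X * n) + suc (2 * (2 * h))
  split = solve-∀
  factor-X : ∀ p X n ℓ → 4 * (p * X * n) + (4 * ℓ + 1) * X ≡ X * (4 * ℓ + 1 + 4 * n * p)
  factor-X = solve-∀

corollary1p6 : (p ℓ : ℕ) → (pp : Prime p) → p ≢ 2 → 1 ≤ ℓ → ℓ ≤ p ∸ 1 →
    legendre (4 * ℓ + 1) p {{prime⇒nonZero pp}} ≡ -[1+ 0 ] →
    (n k : ℕ) →
    4 ∣ b (2 * p ^ (2 * k + 3) * n + ((4 * ℓ + 1) * p ^ (2 * k + 2) ∸ 1) / 2)
corollary1p6 p ℓ pp p≢2 _ _ leg n k = subst (λ i → 4 ∣ b i) (sym index≡2r) (¬square⇒4∣b[2r] r ¬square)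
  where
  instance _ = prime⇒nonZero pp
  X = p ^ (2 * k + 2)
  c-odd = odd-^ (prime≢2⇒odd pp p≢2) (suc k)
  v = proj₁ c-odd
  h = (4 * ℓ + 1) * (v * v + v) + ℓ
  r = p * X * n + h
  [4ℓ+1]X≡4h+1 : (4 * ℓ + 1) * X ≡ suc (2 * (2 * h))
  [4ℓ+1]X≡4h+1 = trans (cong ((4 * ℓ + 1) *_) (trans (^-double p k) (cong (λ c → c * c) (proj₂ c-odd))))
                       ([4ℓ+1]·odd² ℓ v)
  index≡2r : 2 * p ^ (2 * k + 3) * n + ((4 * ℓ + 1) * X ∸ 1) / 2 ≡ 2 * r
  index≡2r = trans (cong (λ y → 2 * p ^ y * n + ((4 * ℓ + 1) * X ∸ 1) / 2) (+-suc (2 * k) 2))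
                   (index≡2[pXn+h] p X n ℓ h [4ℓ+1]X≡4h+1)
  4r+1≡c²M : suc (2 * (2 * r)) ≡ p ^ suc k * p ^ suc k * (4 * ℓ + 1 + 4 * n * p)
  4r+1≡c²M = trans (4[pXn+h]+1≡X[4ℓ+1+4np] p X n ℓ h [4ℓ+1]X≡4h+1)
                   (cong (_* (4 * ℓ + 1 + 4 * n * p)) (^-double p k))
  ¬square : ¬ IsSquare (suc (2 * (2 * r)))
  ¬square = legendre≡-1⇒¬IsSquare (4 * ℓ + 1) (4 * n) p leg
          ∘ IsSquare-cancel-prime-power pp (suc k)
          ∘ subst IsSquare 4r+1≡c²M
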